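{- Let $C$ be either a code in $D(2,1)$ with $|C|=4^2$ and code distance $4$, or a code in $D(1,3)$ with $|C|=4^2$ and code distance $4$. Then the distance between any two distinct codewords of $C$ is exactly $4$.
   Context: The Shrikhande graph $\mathrm{Sh}$ is the Cayley graph on $\mathbb{Z}_4^2$ with connection set $\{01,03,10,30,11,33\}$; $K$ is the complete graph on $\mathbb{Z}_4$. $D(m,n)$ is the Cartesian product of $m$ copies of $\mathrm{Sh}$ and $n$ copies of $K$, with distance equal to the sum of coordinatewise graph distances. The code distance of a code is the minimum distance between distinct codewords. -}

module Defs where

open import Data.Nat using (ℕ; zero; suc; _+_; _%_)
open import Data.Nat.DivMod using (m%n<n)
open import Data.Fin using (Fin; zero; suc; toℕ; fromℕ<)
open import Data.Fin.Properties using (_≟_)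
open import Data.Bool using (Bool; true; false; _∨_; _∧_; if_then_else_)
open import Data.Product using (_×_; _,_)
open import Data.Bool.ListAction using (any)
open import Data.List using (List; []; _∷_; allFin; map; cartesianProduct; concatMap)
open import Relation.Binary.PropositionalEquality using (_≡_)
open import Relation.Nullary using (¬_)
open import Relation.Nullary.Decidable using (⌊_⌋)

Z4 : Set
Z4 = Fin 4

_+₄_ : Z4 → Z4 → Z4
a +₄ b = fromℕ< (m%n<n (toℕ a + toℕ b) 4)

record FinGraph : Set₁ where
  field
    V     : Set
    verts : List V
    eqB   : V → V → Bool
    adj   : V → V → Bool
    bound : ℕ   -- number of vertices; any shortest walk is shorter than this

module _ (G : FinGraph) where
  open FinGraph G

  walk : ℕ → V → V → Bool
  walk zero    x y = eqB x y
  walk (suc k) x y = any (λ z → adj x z ∧ walk k z y) verts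

  search : ℕ → ℕ → V → V → ℕ
  search i zero     x y = i
  search i (suc f)  x y = if walk i x y then i else search (suc i) f x y

  -- graph distance (the graphs used below are connected)
  gdist : V → V → ℕ
  gdist x y = search 0 bound x y

-- The Shrikhande graph: Cayley graph on ℤ₄² with connection set
-- {01,03,10,30,11,33}

Sh-V : Set
Sh-V = Z4 × Z4

eqZ : Z4 → Z4 → Bool
eqZ a b = ⌊ a ≟ b ⌋

eqSh : Sh-V → Sh-V → Bool
eqSh (a , b) (c , d) = eqZ a c ∧ eqZ b d

z0 z1 z3 : Z4
z0 = zero
z1 = suc zero
z3 = suc (suc (suc zero))

connSh : List Sh-V
connSh = (z0 , z1) ∷ (z0 , z3) ∷ (z1 , z0) ∷ (z3 , z0) ∷ (z1 , z1) ∷ (z3 , z3) ∷ []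

adjSh : Sh-V → Sh-V → Bool
adjSh (a , b) y = any (λ { (s , t) → eqSh (a +₄ s , b +₄ t) y }) connSh

Sh : FinGraph
Sh = record
  { V = Sh-V
  ; verts = cartesianProduct (allFin 4) (allFin 4)
  ; eqB = eqSh
  ; adj = adjSh
  ; bound = 16
  }

K : FinGraph
K = record
  { V = Z4
  ; verts = allFin 4
  ; eqB = eqZ
  ; adj = λ a b → if eqZ a b then false else true
  ; bound = 4
  }

dSh : Sh-V → Sh-V → ℕ
dSh = gdist Sh

dK : Z4 → Z4 → ℕ
dK = gdist K

D21 : Set
D21 = Sh-V × Sh-V × Z4

d21 : D21 → D21 → ℕ
d21 (x₁ , x₂ , y) (x₁' , x₂' , y') = dSh x₁ x₁' + dSh x₂ x₂' + dK y y'

D13 : Set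
D13 = Sh-V × Z4 × Z4 × Z4

d13 : D13 → D13 → ℕ
d13 (x , y₁ , y₂ , y₃) (x' , y₁' , y₂' , y₃') =
  dSh x x' + dK y₁ y₁' + dK y₂ y₂' + dK y₃ y₃'

-- A code of size N in a space with distance d: an injective family
-- c : Fin N → P (its image is the code, of cardinality N).
-- Code distance = minimum distance between distinct codewords.

open import Data.Product using (∃-syntax; Σ)

IsCode : {P : Set} (N : ℕ) → (Fin N → P) → Set
IsCode N c = ∀ i j → c i ≡ c j → i ≡ j

HasCodeDistance : {P : Set} {N : ℕ} (d : P → P → ℕ) → (Fin N → P) → ℕ → Set
HasCodeDistance {N = N} d c δ =
  (∀ (i j : Fin N) → ¬ i ≡ j → δ Data.Nat.≤ d (c i) (c j)) ×
  (∃[ i ] ∃[ j ] (¬ i ≡ j × d (c i) (c j) ≡ δ))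

module Submission where

-- Sum the distance over all ordered pairs of codewords.  If N = n+1
-- points are pairwise at distance at least δ, every row sum Σⱼ d(cᵢ,cⱼ) is at
-- least n·δ; so if the sum over all pairs is at most N·n·δ, each row sum and then
-- each single distance is forced to equal δ (the rigidity lemma).  Here N = 16,
-- δ = 4 and N·n·δ = 960, and the upper bound is obtained coordinatewise, since
-- the distances of D(2,1) and D(1,3) are sums of coordinate distances:
--   * a Shrikhande coordinate contributes at most 16·24 = 384: distance 4 forces
--     the projection onto it to be injective, and every vertex of Sh has
--     distance sum 6·1 + 9·2 = 24 to the other vertices;
--   * a complete-graph coordinate contributes 16² − Σ_c n_c² ≤ 256 − 64 = 192,
--     where n_c counts the words with symbol c (Cauchy–Schwarz gives Σ n_c² ≥ 64).

open import Defs
open import Data.Nat using (ℕ)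
open import Data.Fin using (Fin)
open import Data.Product using (_×_)
open import Data.Sum using (_⊎_)
open import Relation.Binary.PropositionalEquality using (_≡_)
open import Relation.Nullary using (¬_)

open import Data.Nat using (zero; suc; _+_; _*_; _≤_; _<_; _≤?_; z≤n; s≤s)
open import Data.Nat.Properties
open import Data.Nat.Tactic.RingSolver using (solve-∀)
open import Data.Fin using (zero; suc; punchIn; punchOut; combine; remQuot)
import Data.Fin.Properties as FinP
open import Data.Product using (_,_; proj₁; proj₂)
open import Data.Sum using (inj₁; inj₂)
open import Data.Bool using (if_then_else_)
open import Data.Unit using (tt)
open import Data.Empty using (⊥-elim)
open import Relation.Binary.PropositionalEquality
  using (refl; sym; trans; cong; cong₂; subst; module ≡-Reasoning)
open import Relation.Nullary using (yes; no)
open import Relation.Nullary.Decidable using (toWitness; ⌊_⌋)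

∑ : ∀ {n} → (Fin n → ℕ) → ℕ
∑ {zero}  f = 0
∑ {suc n} f = f zero + ∑ (λ i → f (suc i))

pairSum : ∀ {n} → (Fin n → Fin n → ℕ) → ℕ
pairSum D = ∑ (λ i → ∑ (D i))

∑-cong : ∀ {n} {f g : Fin n → ℕ} → (∀ i → f i ≡ g i) → ∑ f ≡ ∑ g
∑-cong {zero}  f≡g = refl
∑-cong {suc n} f≡g = cong₂ _+_ (f≡g zero) (∑-cong (λ i → f≡g (suc i)))

∑-mono : ∀ {n} {f g : Fin n → ℕ} → (∀ i → f i ≤ g i) → ∑ f ≤ ∑ g
∑-mono {zero}  f≤g = z≤n
∑-mono {suc n} f≤g = +-mono-≤ (f≤g zero) (∑-mono (λ i → f≤g (suc i)))

∑-const : ∀ n c → ∑ {n} (λ _ → c) ≡ n * c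
∑-const zero    c = refl
∑-const (suc n) c = cong (c +_) (∑-const n c)

∑-+ : ∀ {n} (f g : Fin n → ℕ) → ∑ (λ i → f i + g i) ≡ ∑ f + ∑ g
∑-+ {zero}  f g = refl
∑-+ {suc n} f g =
  trans (cong (f zero + g zero +_) (∑-+ (λ i → f (suc i)) (λ i → g (suc i))))
        (interchange (f zero) (g zero) (∑ (λ i → f (suc i))) (∑ (λ i → g (suc i))))
  where
  interchange : ∀ a b c d → (a + b) + (c + d) ≡ (a + c) + (b + d)
  interchange = solve-∀

∑-*ʳ : ∀ {n} (f : Fin n → ℕ) m → ∑ (λ i → f i * m) ≡ ∑ f * m
∑-*ʳ {zero}  f m = refl
∑-*ʳ {suc n} f m = trans (cong (f zero * m +_) (∑-*ʳ (λ i → f (suc i)) m))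
                         (sym (*-distribʳ-+ m (f zero) (∑ (λ i → f (suc i)))))

∑-*ˡ : ∀ {n} m (f : Fin n → ℕ) → m * ∑ f ≡ ∑ (λ i → m * f i)
∑-*ˡ m f = trans (*-comm m (∑ f))
                 (trans (sym (∑-*ʳ f m)) (∑-cong (λ i → *-comm (f i) m)))

∑-swap : ∀ {m n} (D : Fin m → Fin n → ℕ) → ∑ (λ i → ∑ (D i)) ≡ ∑ (λ j → ∑ (λ i → D i j))
∑-swap {zero}  {n} D = sym (trans (∑-const n 0) (*-zeroʳ n))
∑-swap {suc m}     D = trans (cong (∑ (D zero) +_) (∑-swap (λ i → D (suc i))))
                             (sym (∑-+ (D zero) (λ j → ∑ (λ i → D (suc i) j))))

pairSum-+ : ∀ {n} (D E : Fin n → Fin n → ℕ) →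
            pairSum (λ i j → D i j + E i j) ≡ pairSum D + pairSum E
pairSum-+ D E = trans (∑-cong (λ i → ∑-+ (D i) (E i))) (∑-+ (λ i → ∑ (D i)) (λ i → ∑ (E i)))

∑-remove : ∀ {n} (f : Fin (suc n) → ℕ) i → ∑ f ≡ f i + ∑ (λ k → f (punchIn i k))
∑-remove f zero = refl
∑-remove {suc n} f (suc i) =
  trans (cong (f zero +_) (∑-remove (λ k → f (suc k)) i))
        (+-comm-middle (f zero) (f (suc i)) (∑ (λ k → f (suc (punchIn i k)))))
  where
  +-comm-middle : ∀ a b c → a + (b + c) ≡ b + (a + c)
  +-comm-middle = solve-∀

∑-tight : ∀ {n} (a f : Fin n → ℕ) → (∀ i → a i ≤ f i) → ∑ f ≤ ∑ a → ∀ i → f i ≡ a i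
∑-tight {suc n} a f a≤f ∑f≤∑a i = ≤-antisym (+-cancelʳ-≤ (∑ rest) (f i) (a i) fi+rest≤ai+rest) (a≤f i)
  where
  open ≤-Reasoning
  rest : Fin n → ℕ
  rest k = a (punchIn i k)
  fi+rest≤ai+rest : f i + ∑ rest ≤ a i + ∑ rest
  fi+rest≤ai+rest = begin
    f i + ∑ rest                          ≤⟨ +-monoʳ-≤ (f i) (∑-mono (λ k → a≤f (punchIn i k))) ⟩
    f i + ∑ (λ k → f (punchIn i k))       ≡⟨ sym (∑-remove f i) ⟩
    ∑ f                                   ≤⟨ ∑f≤∑a ⟩
    ∑ a                                   ≡⟨ ∑-remove a i ⟩
    a i + ∑ rest                          ∎

∑-injective-≤ : ∀ {n m} (σ : Fin n → Fin m) → IsCode n σ → (f : Fin m → ℕ) →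
                ∑ (λ i → f (σ i)) ≤ ∑ f
∑-injective-≤ {zero}          σ σ-inj f = z≤n
∑-injective-≤ {suc n} {zero}  σ σ-inj f with σ zero
... | ()
∑-injective-≤ {suc n} {suc m} σ σ-inj f = begin
  f k + ∑ (λ i → f (σ (suc i)))         ≡⟨ cong (f k +_) (∑-cong (λ i → cong f (sym (FinP.punchIn-punchOut (k≢σsuc i))))) ⟩
  f k + ∑ (λ i → f (punchIn k (σ' i)))  ≤⟨ +-monoʳ-≤ (f k) (∑-injective-≤ σ' σ'-inj (λ x → f (punchIn k x))) ⟩
  f k + ∑ (λ x → f (punchIn k x))       ≡⟨ sym (∑-remove f k) ⟩
  ∑ f                                   ∎
  where
  open ≤-Reasoning
  k : Fin (suc m)
  k = σ zero
  k≢σsuc : ∀ i → ¬ k ≡ σ (suc i)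
  k≢σsuc i eq with σ-inj zero (suc i) eq
  ... | ()
  σ' : Fin n → Fin m
  σ' i = punchOut (k≢σsuc i)
  σ'-inj : IsCode n σ'
  σ'-inj i j eq = FinP.suc-injective
    (σ-inj (suc i) (suc j) (FinP.punchOut-injective (k≢σsuc i) (k≢σsuc j) eq))

two-mul≤sq+sq : ∀ a b → 2 * (a * b) ≤ a * a + b * b
two-mul≤sq+sq a b with ≤-total a b
... | inj₁ a≤b with m≤n⇒∃[o]m+o≡n a≤b
...   | k , refl = ≤-trans (m≤m+n _ (k * k)) (≤-reflexive (identity a k))
  where
  identity : ∀ a k → 2 * (a * (a + k)) + k * k ≡ a * a + (a + k) * (a + k)
  identity = solve-∀
two-mul≤sq+sq a b | inj₂ b≤a with m≤n⇒∃[o]m+o≡n b≤a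
...   | k , refl = ≤-trans (m≤m+n _ (k * k)) (≤-reflexive (identity b k))
  where
  identity : ∀ b k → 2 * ((b + k) * b) + k * k ≡ (b + k) * (b + k) + b * b
  identity = solve-∀

cauchy-schwarz : ∀ {n} (x : Fin n → ℕ) → ∑ x * ∑ x ≤ n * ∑ (λ i → x i * x i)
cauchy-schwarz {n} x = *-cancelˡ-≤ 2 (begin
  2 * (∑ x * ∑ x)                            ≡⟨ cong (2 *_) square ⟩
  2 * pairSum (λ i j → x i * x j)            ≡⟨ double ⟩
  pairSum (λ i j → 2 * (x i * x j))          ≤⟨ ∑-mono (λ i → ∑-mono (λ j → two-mul≤sq+sq (x i) (x j))) ⟩
  pairSum (λ i j → x i * x i + x j * x j)    ≡⟨ squares ⟩
  n * Q + n * Q                              ≡⟨ cong (n * Q +_) (sym (+-identityʳ (n * Q))) ⟩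
  2 * (n * Q)                                ∎)
  where
  open ≤-Reasoning
  Q : ℕ
  Q = ∑ (λ i → x i * x i)
  square : ∑ x * ∑ x ≡ pairSum (λ i j → x i * x j)
  square = trans (sym (∑-*ʳ x (∑ x))) (∑-cong (λ i → ∑-*ˡ (x i) x))
  double : 2 * pairSum (λ i j → x i * x j) ≡ pairSum (λ i j → 2 * (x i * x j))
  double = trans (∑-*ˡ 2 (λ i → ∑ (λ j → x i * x j))) (∑-cong (λ i → ∑-*ˡ 2 (λ j → x i * x j)))
  squares : pairSum (λ i j → x i * x i + x j * x j) ≡ n * Q + n * Q
  squares = trans (∑-cong (λ i → trans (∑-+ (λ _ → x i * x i) (λ j → x j * x j))
                                               (cong (_+ Q) (∑-const n (x i * x i)))))
                  (trans (∑-+ (λ i → n * (x i * x i)) (λ _ → Q))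
                         (cong₂ _+_ (sym (∑-*ˡ n (λ i → x i * x i))) (∑-const n Q)))

rigidity : ∀ {n} δ (D : Fin (suc n) → Fin (suc n) → ℕ) →
           (∀ i j → ¬ i ≡ j → δ ≤ D i j) → pairSum D ≤ suc n * (n * δ) →
           ∀ i j → ¬ i ≡ j → D i j ≡ δ
rigidity {n} δ D far pairSum≤ i j i≢j = begin
  D i j                           ≡⟨ cong (D i) (sym (FinP.punchIn-punchOut i≢j)) ⟩
  others i (punchOut i≢j)         ≡⟨ ∑-tight (λ _ → δ) (others i) (others-far i) (others≤ i) (punchOut i≢j) ⟩
  δ                               ∎
  where
  open ≡-Reasoning
  others : ∀ i → Fin n → ℕ
  others i k = D i (punchIn i k)
  others-far : ∀ i k → δ ≤ others i k
  others-far i k = far i (punchIn i k) (λ eq → FinP.punchInᵢ≢i i k (sym eq))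
  row≥ : ∀ i → n * δ ≤ ∑ (D i)
  row≥ i = ≤-trans (≤-reflexive (sym (∑-const n δ)))
    (≤-trans (∑-mono (others-far i)) (≤-trans (m≤n+m _ (D i i)) (≤-reflexive (sym (∑-remove (D i) i)))))
  row≡ : ∀ i → ∑ (D i) ≡ n * δ
  row≡ = ∑-tight (λ _ → n * δ) (λ i → ∑ (D i)) row≥
           (≤-trans pairSum≤ (≤-reflexive (sym (∑-const (suc n) (n * δ)))))
  others≤ : ∀ i → ∑ (others i) ≤ ∑ {n} (λ _ → δ)
  others≤ i = ≤-trans (m≤n+m _ (D i i))
    (≤-reflexive (trans (sym (∑-remove (D i) i)) (trans (row≡ i) (sym (∑-const n δ)))))

projection-isCode : ∀ {A : Set} {N} δ (D : Fin N → Fin N → ℕ) (p : Fin N → A) →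
                    (∀ i j → ¬ i ≡ j → δ ≤ D i j) → (∀ i j → p i ≡ p j → D i j < δ) →
                    IsCode N p
projection-isCode δ D p far close i j pi≡pj with i FinP.≟ j
... | yes i≡j = i≡j
... | no  i≢j = ⊥-elim (<⇒≱ (close i j pi≡pj) (far i j i≢j))

dSh-≡ : ∀ {x y} → x ≡ y → dSh x y ≡ 0
dSh-≡ {a , b} refl = toWitness {a? = FinP.all? λ a → FinP.all? λ b → dSh (a , b) (a , b) ≟ 0} tt a b

dSh≤2 : ∀ x y → dSh x y ≤ 2
dSh≤2 (a , b) (c , d) = toWitness {a? = FinP.all? λ a → FinP.all? λ b → FinP.all? λ c → FinP.all? λ d →
                                     dSh (a , b) (c , d) ≤? 2} tt a b c d

vertex : Fin 16 → Sh-V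
vertex = remQuot 4

index : Sh-V → Fin 16
index (a , b) = combine a b

vertex-index : ∀ x → vertex (index x) ≡ x
vertex-index (a , b) = FinP.remQuot-combine a b

dSh-row : ∀ x → ∑ (λ k → dSh x (vertex k)) ≡ 24
dSh-row (a , b) = toWitness {a? = FinP.all? λ a → FinP.all? λ b →
                               ∑ (λ k → dSh (a , b) (vertex k)) ≟ 24} tt a b

-- Summing a vertex function over distinct vertices p j gives at most its sum
-- over all vertices.  (F is kept abstract so that its values are never evaluated.)
∑-distinct-vertices-≤ : ∀ {N} (p : Fin N → Sh-V) → IsCode N p → (F : Sh-V → ℕ) →
                        ∑ (λ j → F (p j)) ≤ ∑ (λ k → F (vertex k))
∑-distinct-vertices-≤ p p-inj F = begin
  ∑ (λ j → F (p j))                  ≡⟨ ∑-cong (λ j → cong F (sym (vertex-index (p j)))) ⟩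
  ∑ (λ j → F (vertex (index (p j)))) ≤⟨ ∑-injective-≤ (λ j → index (p j)) index∘p-inj (λ k → F (vertex k)) ⟩
  ∑ (λ k → F (vertex k))             ∎
  where
  open ≤-Reasoning
  index∘p-inj : IsCode _ (λ j → index (p j))
  index∘p-inj i j eq = p-inj i j
    (trans (sym (vertex-index (p i))) (trans (cong vertex eq) (vertex-index (p j))))

sh-pairSum-bound : ∀ {N} (p : Fin N → Sh-V) → IsCode N p →
                   pairSum (λ i j → dSh (p i) (p j)) ≤ N * 24
sh-pairSum-bound {N} p p-inj = ≤-trans (∑-mono row≤24) (≤-reflexive (∑-const N 24))
  where
  row≤24 : ∀ i → ∑ (λ j → dSh (p i) (p j)) ≤ 24
  row≤24 i = subst (∑ (λ j → dSh (p i) (p j)) ≤_) (dSh-row (p i))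
                   (∑-distinct-vertices-≤ p p-inj (dSh (p i)))

indicator : ∀ {k} → Fin k → Fin k → ℕ
indicator a b = if ⌊ a FinP.≟ b ⌋ then 1 else 0

indicator-refl : ∀ {k} (a : Fin k) → indicator a a ≡ 1
indicator-refl a with a FinP.≟ a
... | yes _   = refl
... | no  a≢a = ⊥-elim (a≢a refl)

indicator-≢ : ∀ {k} {a b : Fin k} → ¬ a ≡ b → indicator a b ≡ 0
indicator-≢ {a = a} {b} a≢b with a FinP.≟ b
... | yes a≡b = ⊥-elim (a≢b a≡b)
... | no  _   = refl

∑-indicator : ∀ {k} (a : Fin (suc k)) (g : Fin (suc k) → ℕ) → ∑ (λ c → indicator a c * g c) ≡ g a
∑-indicator {k} a g = begin
  ∑ (λ c → indicator a c * g c)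
    ≡⟨ ∑-remove (λ c → indicator a c * g c) a ⟩
  indicator a a * g a + ∑ (λ l → indicator a (punchIn a l) * g (punchIn a l))
    ≡⟨ cong₂ _+_ (cong (_* g a) (indicator-refl a)) (∑-cong off-point) ⟩
  1 * g a + ∑ {k} (λ _ → 0)
    ≡⟨ cong₂ _+_ (*-identityˡ (g a)) (trans (∑-const k 0) (*-zeroʳ k)) ⟩
  g a + 0
    ≡⟨ +-identityʳ (g a) ⟩
  g a ∎
  where
  open ≡-Reasoning
  off-point : ∀ l → indicator a (punchIn a l) * g (punchIn a l) ≡ 0
  off-point l = cong (_* g (punchIn a l)) (indicator-≢ (λ eq → FinP.punchInᵢ≢i a l (sym eq)))

count : ∀ {N k} → (Fin N → Fin (suc k)) → Fin (suc k) → ℕ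
count h c = ∑ (λ j → indicator (h j) c)

-- Every word carries exactly one symbol, so the counts add up to N.
count-total : ∀ {N k} (h : Fin N → Fin (suc k)) → ∑ (count h) ≡ N
count-total {N} h = begin
  ∑ (λ c → ∑ (λ j → indicator (h j) c))  ≡⟨ ∑-swap (λ c j → indicator (h j) c) ⟩
  ∑ (λ j → ∑ (λ c → indicator (h j) c))  ≡⟨ ∑-cong one-symbol ⟩
  ∑ {N} (λ _ → 1)                        ≡⟨ trans (∑-const N 1) (*-identityʳ N) ⟩
  N                                      ∎
  where
  open ≡-Reasoning
  one-symbol : ∀ j → ∑ (λ c → indicator (h j) c) ≡ 1
  one-symbol j = trans (∑-cong (λ c → sym (*-identityʳ (indicator (h j) c))))
                       (∑-indicator (h j) (λ _ → 1))

-- Σᵢ n_{h i} = Σ_c n_c²: each symbol c is counted once for each of its n_c words.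
count-at-words : ∀ {N k} (h : Fin N → Fin (suc k)) →
                 ∑ (λ i → count h (h i)) ≡ ∑ (λ c → count h c * count h c)
count-at-words h = begin
  ∑ (λ i → count h (h i))                              ≡⟨ ∑-cong (λ i → sym (∑-indicator (h i) (count h))) ⟩
  ∑ (λ i → ∑ (λ c → indicator (h i) c * count h c))    ≡⟨ ∑-swap (λ i c → indicator (h i) c * count h c) ⟩
  ∑ (λ c → ∑ (λ i → indicator (h i) c * count h c))    ≡⟨ ∑-cong (λ c → ∑-*ʳ (λ i → indicator (h i) c) (count h c)) ⟩
  ∑ (λ c → count h c * count h c)                      ∎
  where open ≡-Reasoning

dK≤1 : ∀ a b → dK a b ≤ 1
dK≤1 = toWitness {a? = FinP.all? λ a → FinP.all? λ b → dK a b ≤? 1} tt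

dK-indicator : ∀ a b → dK a b + indicator b a ≡ 1
dK-indicator = toWitness {a? = FinP.all? λ a → FinP.all? λ b → dK a b + indicator b a ≟ 1} tt

-- Row i has distance 1 to every word except the n_{h i} words sharing its symbol.
k-pairSum : ∀ {N} (h : Fin N → Z4) →
            pairSum (λ i j → dK (h i) (h j)) + ∑ (λ c → count h c * count h c) ≡ N * N
k-pairSum {N} h = begin
  T + ∑ (λ c → count h c * count h c)
    ≡⟨ cong (T +_) (sym (count-at-words h)) ⟩
  T + ∑ (λ i → count h (h i))
    ≡⟨ sym (∑-+ (λ i → ∑ (λ j → dK (h i) (h j))) (λ i → count h (h i))) ⟩
  ∑ (λ i → ∑ (λ j → dK (h i) (h j)) + ∑ (λ j → indicator (h j) (h i)))
    ≡⟨ ∑-cong (λ i → sym (∑-+ (λ j → dK (h i) (h j)) (λ j → indicator (h j) (h i)))) ⟩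
  pairSum (λ i j → dK (h i) (h j) + indicator (h j) (h i))
    ≡⟨ ∑-cong (λ i → ∑-cong (λ j → dK-indicator (h i) (h j))) ⟩
  ∑ {N} (λ _ → ∑ {N} (λ _ → 1))
    ≡⟨ ∑-cong {N} (λ _ → trans (∑-const N 1) (*-identityʳ N)) ⟩
  ∑ {N} (λ _ → N)
    ≡⟨ ∑-const N N ⟩
  N * N ∎
  where
  open ≡-Reasoning
  T : ℕ
  T = pairSum (λ i j → dK (h i) (h j))

-- By Cauchy–Schwarz Σ_c n_c² ≥ N²/4, so the pair sum is at most (3/4)·N².
k-pairSum-bound : ∀ {N} (h : Fin N → Z4) → 4 * pairSum (λ i j → dK (h i) (h j)) ≤ 3 * (N * N)
k-pairSum-bound {N} h = +-cancelʳ-≤ (N * N) (4 * T) (3 * (N * N)) (begin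
  4 * T + N * N   ≤⟨ +-monoʳ-≤ (4 * T) N²≤4Q ⟩
  4 * T + 4 * Q   ≡⟨ sym (*-distribˡ-+ 4 T Q) ⟩
  4 * (T + Q)     ≡⟨ cong (4 *_) (k-pairSum h) ⟩
  4 * (N * N)     ≡⟨ +-comm (N * N) (3 * (N * N)) ⟩
  3 * (N * N) + N * N ∎)
  where
  open ≤-Reasoning
  T Q : ℕ
  T = pairSum (λ i j → dK (h i) (h j))
  Q = ∑ (λ c → count h c * count h c)
  N²≤4Q : N * N ≤ 4 * Q
  N²≤4Q = subst (λ s → s * s ≤ 4 * Q) (count-total h) (cauchy-schwarz (count h))

d21-pairSum-split : ∀ {N} (c : Fin N → D21) →
  pairSum (λ i j → d21 (c i) (c j)) ≡
    pairSum (λ i j → dSh (proj₁ (c i)) (proj₁ (c j)))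
    + pairSum (λ i j → dSh (proj₁ (proj₂ (c i))) (proj₁ (proj₂ (c j))))
    + pairSum (λ i j → dK (proj₂ (proj₂ (c i))) (proj₂ (proj₂ (c j))))
d21-pairSum-split c =
  trans (pairSum-+ (λ i j → S₁ i j + S₂ i j) K₃) (cong (_+ pairSum K₃) (pairSum-+ S₁ S₂))
  where
  S₁ S₂ K₃ : _ → _ → ℕ
  S₁ i j = dSh (proj₁ (c i)) (proj₁ (c j))
  S₂ i j = dSh (proj₁ (proj₂ (c i))) (proj₁ (proj₂ (c j)))
  K₃ i j = dK (proj₂ (proj₂ (c i))) (proj₂ (proj₂ (c j)))

d13-pairSum-split : ∀ {N} (c : Fin N → D13) →
  pairSum (λ i j → d13 (c i) (c j)) ≡
    pairSum (λ i j → dSh (proj₁ (c i)) (proj₁ (c j)))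
    + pairSum (λ i j → dK (proj₁ (proj₂ (c i))) (proj₁ (proj₂ (c j))))
    + pairSum (λ i j → dK (proj₁ (proj₂ (proj₂ (c i)))) (proj₁ (proj₂ (proj₂ (c j)))))
    + pairSum (λ i j → dK (proj₂ (proj₂ (proj₂ (c i)))) (proj₂ (proj₂ (proj₂ (c j)))))
d13-pairSum-split c =
  trans (pairSum-+ (λ i j → S₀ i j + K₁ i j + K₂ i j) K₃)
    (cong (_+ pairSum K₃) (trans (pairSum-+ (λ i j → S₀ i j + K₁ i j) K₂)
      (cong (_+ pairSum K₂) (pairSum-+ S₀ K₁))))
  where
  S₀ K₁ K₂ K₃ : _ → _ → ℕ
  S₀ i j = dSh (proj₁ (c i)) (proj₁ (c j))
  K₁ i j = dK (proj₁ (proj₂ (c i))) (proj₁ (proj₂ (c j)))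
  K₂ i j = dK (proj₁ (proj₂ (proj₂ (c i)))) (proj₁ (proj₂ (proj₂ (c j))))
  K₃ i j = dK (proj₂ (proj₂ (proj₂ (c i)))) (proj₂ (proj₂ (proj₂ (c j))))

-- The pair-sum bound 960 = 16·15·4 for codes of size 16 and minimum distance 4.
-- Minimum distance 4 makes each Shrikhande projection injective, because the
-- remaining coordinates contribute at most 2 + 1 (resp. 1 + 1 + 1) < 4.

k-pairSum-bound₁₆ : (h : Fin 16 → Z4) → pairSum (λ i j → dK (h i) (h j)) ≤ 192
k-pairSum-bound₁₆ h = *-cancelˡ-≤ 4 (k-pairSum-bound h)

d21-pairSum-bound : (c : Fin 16 → D21) → (∀ i j → ¬ i ≡ j → 4 ≤ d21 (c i) (c j)) →
                    pairSum (λ i j → d21 (c i) (c j)) ≤ 960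
d21-pairSum-bound c far = ≤-trans (≤-reflexive (d21-pairSum-split c))
  (+-mono-≤ (+-mono-≤ (sh-pairSum-bound (λ i → proj₁ (c i)) x₁-inj)
                      (sh-pairSum-bound (λ i → proj₁ (proj₂ (c i))) x₂-inj))
            (k-pairSum-bound₁₆ (λ i → proj₂ (proj₂ (c i)))))
  where
  x₁ x₂ : Fin 16 → Sh-V
  x₁ i = proj₁ (c i)
  x₂ i = proj₁ (proj₂ (c i))
  y : Fin 16 → Z4
  y i = proj₂ (proj₂ (c i))
  x₁-inj : IsCode 16 x₁
  x₁-inj = projection-isCode 4 (λ i j → d21 (c i) (c j)) x₁ far λ i j eq →
    s≤s (+-mono-≤ (+-mono-≤ (≤-reflexive (dSh-≡ eq)) (dSh≤2 (x₂ i) (x₂ j))) (dK≤1 (y i) (y j)))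
  x₂-inj : IsCode 16 x₂
  x₂-inj = projection-isCode 4 (λ i j → d21 (c i) (c j)) x₂ far λ i j eq →
    s≤s (+-mono-≤ (+-mono-≤ (dSh≤2 (x₁ i) (x₁ j)) (≤-reflexive (dSh-≡ eq))) (dK≤1 (y i) (y j)))

d13-pairSum-bound : (c : Fin 16 → D13) → (∀ i j → ¬ i ≡ j → 4 ≤ d13 (c i) (c j)) →
                    pairSum (λ i j → d13 (c i) (c j)) ≤ 960
d13-pairSum-bound c far = ≤-trans (≤-reflexive (d13-pairSum-split c))
  (+-mono-≤ (+-mono-≤ (+-mono-≤ (sh-pairSum-bound (λ i → proj₁ (c i)) x-inj)
                                (k-pairSum-bound₁₆ (λ i → proj₁ (proj₂ (c i)))))
                      (k-pairSum-bound₁₆ (λ i → proj₁ (proj₂ (proj₂ (c i))))))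
            (k-pairSum-bound₁₆ (λ i → proj₂ (proj₂ (proj₂ (c i))))))
  where
  y₁ y₂ y₃ : Fin 16 → Z4
  y₁ i = proj₁ (proj₂ (c i))
  y₂ i = proj₁ (proj₂ (proj₂ (c i)))
  y₃ i = proj₂ (proj₂ (proj₂ (c i)))
  x : Fin 16 → Sh-V
  x i = proj₁ (c i)
  x-inj : IsCode 16 x
  x-inj = projection-isCode 4 (λ i j → d13 (c i) (c j)) x far λ i j eq →
    s≤s (+-mono-≤ (+-mono-≤ (+-mono-≤ (≤-reflexive (dSh-≡ eq)) (dK≤1 (y₁ i) (y₁ j)))
                            (dK≤1 (y₂ i) (y₂ j))) (dK≤1 (y₃ i) (y₃ j)))

-- Main theorem: only the minimum-distance half of HasCodeDistance is needed.

lemma11 : ((c : Fin 16 → D21) → IsCode 16 c → HasCodeDistance d21 c 4 →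
    ∀ i j → ¬ i ≡ j → d21 (c i) (c j) ≡ 4)
    × ((c : Fin 16 → D13) → IsCode 16 c → HasCodeDistance d13 c 4 →
    ∀ i j → ¬ i ≡ j → d13 (c i) (c j) ≡ 4)
lemma11 =
  (λ c _ (far , _) → rigidity 4 (λ i j → d21 (c i) (c j)) far (d21-pairSum-bound c far)) ,
  (λ c _ (far , _) → rigidity 4 (λ i j → d13 (c i) (c j)) far (d13-pairSum-bound c far))
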